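{- Let $f:\{0,1\}^n\to\{0,1\}^n$ be a Boolean network. If $f$ has at least $n$ limit cycles of length at least $3$, then $K_n\in\mathcal{G}(f)$.
   Context: A Boolean network with $n$ components is a map $f:\{0,1\}^n\to\{0,1\}^n$, $x\mapsto(f_1(x),\dots,f_n(x))$. Let $\Gamma(f)$ be the digraph on $\{0,1\}^n$ with an arc from $x$ to $f(x)$ for each $x$; a limit cycle of $f$ is a cycle of $\Gamma(f)$, and its length is its number of vertices. For $i\in[n]$, $e_i$ is the configuration with a $1$ exactly in component $i$, and $x+y$ is componentwise addition modulo 2. The interaction graph $G(f)$ has vertex set $[n]$ and an arc from $j$ to $i$ (loops allowed) iff there is $x$ with $f_i(x)\neq f_i(x+e_j)$. Networks $f,h$ are isomorphic if $h\circ\pi=\pi\circ f$ for some permutation $\pi$ of $\{0,1\}^n$; $\mathcal{G}(f)$ is the set of $G(h)$ for all $h$ isomorphic to $f$. $K_n$ is the complete digraph on $[n]$ with all $n^2$ arcs (including loops). -}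

module Defs where

open import Data.Nat using (ℕ; zero; suc; _≤_; _<_)
open import Data.Fin using (Fin)
open import Data.Bool using (Bool; not)
open import Data.Vec using (Vec; lookup; updateAt)
open import Data.Product using (Σ; _×_; ∃)
open import Relation.Binary.PropositionalEquality using (_≡_; _≢_)
open import Function.Bundles using (_↔_; Inverse)

Config : ℕ → Set
Config n = Vec Bool n

BN : ℕ → Set
BN n = Config n → Config n

comp : ∀ {n} → BN n → Fin n → Config n → Bool
comp f i x = lookup (f x) i

flip : ∀ {n} → Config n → Fin n → Config n
flip x j = updateAt x j not

iter : ∀ {n} → BN n → ℕ → Config n → Config n
iter f zero    x = x
iter f (suc k) x = f (iter f k x)

OnCycleOfLength : ∀ {n} → BN n → Config n → ℕ → Set
OnCycleOfLength f x ℓ =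
  (1 ≤ ℓ) × (iter f ℓ x ≡ x) × (∀ k → 1 ≤ k → k < ℓ → iter f k x ≢ x)

-- f has at least m limit cycles of length at least 3:
-- representatives c 0, …, c (m-1), each on a cycle of length ≥ 3,
-- lying on pairwise different cycles
AtLeastCyclesOfLength≥3 : ∀ {n} → BN n → ℕ → Set
AtLeastCyclesOfLength≥3 {n} f m =
  Σ (Fin m → Config n) λ c →
    (∀ i → Σ ℕ λ ℓ → (3 ≤ ℓ) × OnCycleOfLength f (c i) ℓ) ×
    (∀ i j → i ≢ j → ∀ k → iter f k (c i) ≢ c j)

Arc : ∀ {n} → BN n → Fin n → Fin n → Set
Arc f j i = ∃ λ x → comp f i x ≢ comp f i (flip x j)

IsComplete : ∀ {n} → BN n → Set
IsComplete f = ∀ j i → Arc f j i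

Isomorphic : ∀ {n} → BN n → BN n → Set
Isomorphic {n} f h =
  Σ (Config n ↔ Config n) λ π →
    ∀ x → h (Inverse.to π x) ≡ Inverse.to π (f x)

Kn∈𝒢 : ∀ {n} → BN n → Set
Kn∈𝒢 {n} f = Σ (BN n) λ h → Isomorphic f h × IsComplete h

-- The points x, f x, f² x of the n given cycles are 3n distinct configurations, so 3n ≤ 2ⁿ,
-- i.e. n = 0 or n ≥ 4. Conjugating f by a permutation of {0,1}ⁿ sends these points to any 3n
-- distinct configurations we like. With s the rotation i ↦ i - 1 of [n], take for the j-th
-- cycle A_j = e_j + e_{s j}, B_j = e_{s j} and C_j = ¬ B_j; they have sizes 2, 1 and n - 1, and
-- are distinct within each size because s has no points of period 1 or 2. The conjugate h maps
-- A_j ↦ B_j ↦ C_j, and since A_j + e_j = B_j, flipping component j of A_j complements every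
-- component of h A_j, so j → i is an arc of G(h) for every i.
module Submission where

open import Defs
open import Data.Nat as ℕ using (ℕ; zero; suc; _+_; _∸_; _*_; _^_; _≤_; _<_; z≤n; s≤s)
import Data.Nat.Properties as ℕ
open import Data.Fin as Fin using (Fin; toℕ; fromℕ; inject₁; combine; remQuot)
  renaming (zero to 0F)
import Data.Fin.Properties as Fin
open import Data.Fin.Subset using (Subset; ⁅_⁆; _∪_; ∁; ∣_∣; _∈_; _∉_; inside; outside)
open import Data.Fin.Subset.Properties
  using (x∈⁅x⁆; x∈⁅y⁆⇒x≡y; ∣⁅x⁆∣≡1; ∣∁p∣≡n∸∣p∣; x∈p∪q⁺; x∈p∪q⁻; ∪-identityˡ; ∪-identityʳ)
open import Data.Bool using (not)
import Data.Bool.Properties as Bool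
open import Data.Vec using ([]; _∷_; lookup; here; there)
import Data.Vec.Properties as Vec
open import Data.Product using (Σ; _×_; _,_; proj₁; proj₂)
open import Data.Sum as Sum using (_⊎_; inj₁; inj₂)
open import Function using (_∘_)
open import Function.Bundles using (_↔_; Inverse; Injection; mk↔ₛ′)
open import Function.Definitions using (Injective)
open import Function.Properties.Inverse using (↔-refl; ↔⇒↣)
open import Function.Construct.Composition using (_↔-∘_)
open import Function.Construct.Symmetry using (↔-sym)
open import Relation.Binary.Definitions using (DecidableEquality; tri<; tri≈; tri>)
open import Relation.Binary.PropositionalEquality
open import Relation.Nullary using (yes; no; contradiction)
open import Relation.Nullary.Decidable using (from-no)

pattern 1F = Fin.suc 0F
pattern 2F = Fin.suc 1F

Injective≡ : {A B : Set} → (A → B) → Set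
Injective≡ = Injective _≡_ _≡_

remQuot-injective : ∀ {m} k → Injective≡ (remQuot {m} k)
remQuot-injective {m} k = Injection.injective (↔⇒↣ (Fin.*↔× {m} {k}))

encode : ∀ {n} → Config n → Fin (2 ^ n)
encode []      = 0F
encode (b ∷ x) = combine (Inverse.from Fin.2↔Bool b) (encode x)

encode-injective : ∀ {n} → Injective≡ (encode {n})
encode-injective {x = []}    {[]}    _ = refl
encode-injective {x = a ∷ x} {b ∷ y} e
  with heads , tails ← Fin.combine-injective _ _ _ _ e
  = cong₂ _∷_ (Injection.injective (↔⇒↣ (↔-sym Fin.2↔Bool)) heads) (encode-injective tails)

injective⇒*≤^ : ∀ {n m k} {P : Fin m × Fin k → Config n} → Injective≡ P → m * k ≤ 2 ^ n
injective⇒*≤^ {m = m} {k} P-inj =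
  Fin.injective⇒≤ (remQuot-injective {m} k ∘ P-inj ∘ encode-injective)

module _ {n : ℕ} (f : BN n) where

  iter-+ : ∀ m k x → iter f (m + k) x ≡ iter f m (iter f k x)
  iter-+ zero    k x = refl
  iter-+ (suc m) k x = cong f (iter-+ m k x)

  iter-return : ∀ {x y ℓ} a b → iter f ℓ y ≡ y → b ≤ ℓ →
                iter f a x ≡ iter f b y → iter f (ℓ ∸ b + a) x ≡ y
  iter-return {x} {y} {ℓ} a b back b≤ℓ eq = begin
    iter f (ℓ ∸ b + a) x         ≡⟨ iter-+ (ℓ ∸ b) a x ⟩
    iter f (ℓ ∸ b) (iter f a x)  ≡⟨ cong (iter f (ℓ ∸ b)) eq ⟩
    iter f (ℓ ∸ b) (iter f b y)  ≡⟨ iter-+ (ℓ ∸ b) b y ⟨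
    iter f (ℓ ∸ b + b) y         ≡⟨ cong (λ k → iter f k y) (ℕ.m∸n+n≡m b≤ℓ) ⟩
    iter f ℓ y                   ≡⟨ back ⟩
    y                            ∎
    where open ≡-Reasoning

  cycle-iter-≢ : ∀ {x ℓ} → OnCycleOfLength f x ℓ →
                 ∀ {a b} → a < b → b < ℓ → iter f a x ≢ iter f b x
  cycle-iter-≢ {x} {ℓ} (_ , back , no-return) {a} {b} a<b b<ℓ eq =
    no-return (ℓ ∸ b + a) 1≤ <ℓ (iter-return a b back (ℕ.<⇒≤ b<ℓ) eq)
    where
    1≤ : 1 ≤ ℓ ∸ b + a
    1≤ = ℕ.≤-trans (ℕ.m<n⇒0<n∸m b<ℓ) (ℕ.m≤m+n (ℓ ∸ b) a)
    <ℓ : ℓ ∸ b + a < ℓ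
    <ℓ = subst (ℓ ∸ b + a <_) (ℕ.m∸n+n≡m (ℕ.<⇒≤ b<ℓ)) (ℕ.+-monoʳ-< (ℓ ∸ b) a<b)

  cycle-iter-injective : ∀ {x ℓ} → OnCycleOfLength f x ℓ →
                         ∀ {a b} → a < ℓ → b < ℓ → iter f a x ≡ iter f b x → a ≡ b
  cycle-iter-injective cyc {a} {b} a<ℓ b<ℓ eq with ℕ.<-cmp a b
  ... | tri< a<b _ _ = contradiction eq (cycle-iter-≢ cyc a<b b<ℓ)
  ... | tri≈ _ a≡b _ = a≡b
  ... | tri> _ _ b<a = contradiction (sym eq) (cycle-iter-≢ cyc b<a a<ℓ)

-- A record, not a Π-type: h is then inferable from Paths h T, and the conjugated networks
-- below (expensive to normalise) are never unfolded when such types are compared.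
record Paths {n m} (f : BN n) (P : Fin m × Fin 3 → Config n) : Set where
  field
    first-step  : ∀ j → f (P (j , 0F)) ≡ P (j , 1F)
    second-step : ∀ j → f (P (j , 1F)) ≡ P (j , 2F)

module _ {n m : ℕ} {f : BN n} (cycles : AtLeastCyclesOfLength≥3 f m) where

  private
    c : Fin m → Config n
    c = proj₁ cycles

    ℓ : Fin m → ℕ
    ℓ j = proj₁ (proj₁ (proj₂ cycles) j)

    on-cycle : ∀ j → OnCycleOfLength f (c j) (ℓ j)
    on-cycle j = proj₂ (proj₂ (proj₁ (proj₂ cycles) j))

    <ℓ : ∀ j (a : Fin 3) → toℕ a < ℓ j
    <ℓ j a = ℕ.<-≤-trans (Fin.toℕ<n a) (proj₁ (proj₂ (proj₁ (proj₂ cycles) j)))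

  first-points : Fin m × Fin 3 → Config n
  first-points (j , a) = iter f (toℕ a) (c j)

  first-points-injective : Injective≡ first-points
  first-points-injective {j , a} {k , b} eq with j Fin.≟ k
  ... | no j≢k   = contradiction
    (iter-return f (toℕ a) (toℕ b) (proj₁ (proj₂ (on-cycle k))) (ℕ.<⇒≤ (<ℓ k b)) eq)
    (proj₂ (proj₂ cycles) j k j≢k (ℓ k ∸ toℕ b + toℕ a))
  ... | yes refl = cong (j ,_)
    (Fin.toℕ-injective (cycle-iter-injective f (on-cycle j) (<ℓ j a) (<ℓ j b) eq))

  first-points-paths : Paths f first-points
  first-points-paths = record { first-step = λ _ → refl ; second-step = λ _ → refl }

  cycles⇒m*3≤2^n : m * 3 ≤ 2 ^ n
  cycles⇒m*3≤2^n = injective⇒*≤^ first-points-injective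

module _ {X : Set} (_≟_ : DecidableEquality X) where

  swap : X → X → X → X
  swap a b x with x ≟ a
  ... | yes _ = b
  ... | no _ with x ≟ b
  ...   | yes _ = a
  ...   | no _  = x

  swap-left : ∀ a b → swap a b a ≡ b
  swap-left a b with a ≟ a
  ... | yes _   = refl
  ... | no a≢a = contradiction refl a≢a

  swap-right : ∀ a b → swap a b b ≡ a
  swap-right a b with b ≟ a
  ... | yes b≡a = b≡a
  ... | no _ with b ≟ b
  ...   | yes _   = refl
  ...   | no b≢b = contradiction refl b≢b

  swap-other : ∀ {a b x} → x ≢ a → x ≢ b → swap a b x ≡ x
  swap-other {a} {b} {x} x≢a x≢b with x ≟ a
  ... | yes x≡a = contradiction x≡a x≢a
  ... | no _ with x ≟ b
  ...   | yes x≡b = contradiction x≡b x≢b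
  ...   | no _    = refl

  swap-involutive : ∀ a b x → swap a b (swap a b x) ≡ x
  swap-involutive a b x with x ≟ a
  ... | yes refl = swap-right x b
  ... | no x≢a with x ≟ b
  ...   | yes refl = swap-left a x
  ...   | no x≢b   = swap-other x≢a x≢b

  transposition : X → X → X ↔ X
  transposition a b = mk↔ₛ′ (swap a b) (swap a b) (swap-involutive a b) (swap-involutive a b)

  extend-injection : ∀ {N} (s t : Fin N → X) → Injective≡ s → Injective≡ t →
                     Σ (X ↔ X) λ π → ∀ i → Inverse.to π (s i) ≡ t i
  extend-injection {zero}  s t _ _ = ↔-refl , λ ()
  extend-injection {suc N} s t s-inj t-inj
    with π↔ , π-maps ← extend-injection (s ∘ Fin.suc) (t ∘ Fin.suc)
                         (Fin.suc-injective ∘ s-inj) (Fin.suc-injective ∘ t-inj)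
    = transposition (t 0F) (π (s 0F)) ↔-∘ π↔ , maps
    where
    π : X → X
    π = Inverse.to π↔
    maps : ∀ i → swap (t 0F) (π (s 0F)) (π (s i)) ≡ t i
    maps 0F = swap-right _ _
    maps (Fin.suc i) rewrite π-maps i =
      swap-other (suc≢0 ∘ t-inj)
                 (suc≢0 ∘ s-inj ∘ Injection.injective (↔⇒↣ π↔) ∘ trans (π-maps i))
      where
      suc≢0 : Fin.suc i ≢ 0F
      suc≢0 = Fin.0≢1+n ∘ sym

conjugate : ∀ {n} → Config n ↔ Config n → BN n → BN n
conjugate π f = Inverse.to π ∘ f ∘ Inverse.from π

conjugate-isomorphic : ∀ {n} (π : Config n ↔ Config n) (f : BN n) → Isomorphic f (conjugate π f)
conjugate-isomorphic π f = π , λ x → cong (Inverse.to π ∘ f) (Inverse.strictlyInverseʳ π x)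

relabel-paths : ∀ {n m} {f : BN n} {P T : Fin m × Fin 3 → Config n} →
                Injective≡ P → Injective≡ T → Paths f P →
                Σ (BN n) λ h → Isomorphic f h × Paths h T
relabel-paths {n} {m} {f} {P} {T} P-inj T-inj f-paths
  with π , π-maps′ ← extend-injection (Vec.≡-dec Bool._≟_) (P ∘ remQuot {m} 3) (T ∘ remQuot {m} 3)
                       (remQuot-injective 3 ∘ P-inj) (remQuot-injective 3 ∘ T-inj)
  = conjugate π f , conjugate-isomorphic π f , h-paths
  where
  π-maps : ∀ p → Inverse.to π (P p) ≡ T p
  π-maps (j , a) = subst (λ q → Inverse.to π (P q) ≡ T q) (Fin.remQuot-combine {m} {3} j a)
                     (π-maps′ (combine j a))
  π-maps⁻¹ : ∀ p → Inverse.from π (T p) ≡ P p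
  π-maps⁻¹ p = trans (cong (Inverse.from π) (sym (π-maps p))) (Inverse.strictlyInverseʳ π (P p))
  step : ∀ {p q} → f (P p) ≡ P q → conjugate π f (T p) ≡ T q
  step {p} {q} eq = begin
    Inverse.to π (f (Inverse.from π (T p)))  ≡⟨ cong (Inverse.to π ∘ f) (π-maps⁻¹ p) ⟩
    Inverse.to π (f (P p))                   ≡⟨ cong (Inverse.to π) eq ⟩
    Inverse.to π (P q)                       ≡⟨ π-maps q ⟩
    T q                                      ∎
    where open ≡-Reasoning
  h-paths : Paths (conjugate π f) T
  h-paths = record { first-step = step ∘ first-step ; second-step = step ∘ second-step }
    where open Paths f-paths

flip-complements⇒complete : ∀ {n} {h : BN n} →
  (∀ j → Σ (Config n) λ x → h (flip x j) ≡ ∁ (h x)) → IsComplete h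
flip-complements⇒complete {h = h} flips j i with x , x-flip ← flips j =
  x , λ eq → Bool.not-¬ refl (trans eq (begin
    lookup (h (flip x j)) i  ≡⟨ cong (λ y → lookup y i) x-flip ⟩
    lookup (∁ (h x)) i       ≡⟨ Vec.lookup-map i not (h x) ⟩
    not (lookup (h x) i)     ∎))
  where open ≡-Reasoning

module _ {n : ℕ} where

  ⁅⁆-injective : Injective≡ (⁅_⁆ {n})
  ⁅⁆-injective {x} {y} eq = x∈⁅y⁆⇒x≡y y (subst (x ∈_) eq (x∈⁅x⁆ x))

  ∁-involutive : (p : Subset n) → ∁ (∁ p) ≡ p
  ∁-involutive p =
    trans (sym (Vec.map-∘ not not p)) (trans (Vec.map-cong Bool.not-involutive p) (Vec.map-id p))

  ∁-injective : Injective≡ (∁ {n})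
  ∁-injective {p} {q} eq = trans (sym (∁-involutive p)) (trans (cong ∁ eq) (∁-involutive q))

∣⁅x⁆∪⁅y⁆∣≡2 : ∀ {n} {x y : Fin n} → x ≢ y → ∣ ⁅ x ⁆ ∪ ⁅ y ⁆ ∣ ≡ 2
∣⁅x⁆∪⁅y⁆∣≡2 {x = 0F}       {0F}       x≢y = contradiction refl x≢y
∣⁅x⁆∪⁅y⁆∣≡2 {x = 0F}       {Fin.suc y} _  =
  cong suc (trans (cong ∣_∣ (∪-identityˡ ⁅ y ⁆)) (∣⁅x⁆∣≡1 y))
∣⁅x⁆∪⁅y⁆∣≡2 {x = Fin.suc x} {0F}       _  =
  cong suc (trans (cong ∣_∣ (∪-identityʳ ⁅ x ⁆)) (∣⁅x⁆∣≡1 x))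
∣⁅x⁆∪⁅y⁆∣≡2 {x = Fin.suc x} {Fin.suc y} x≢y = ∣⁅x⁆∪⁅y⁆∣≡2 (x≢y ∘ cong Fin.suc)

∈⁅y⁆∪⁅z⁆ : ∀ {n} {x y z : Fin n} → x ∈ ⁅ y ⁆ ∪ ⁅ z ⁆ → x ≡ y ⊎ x ≡ z
∈⁅y⁆∪⁅z⁆ {y = y} {z} = Sum.map (x∈⁅y⁆⇒x≡y y) (x∈⁅y⁆⇒x≡y z) ∘ x∈p∪q⁻ ⁅ y ⁆ ⁅ z ⁆

flip-⁅x⁆∪p : ∀ {n} {x : Fin n} (p : Subset n) → x ∉ p → flip (⁅ x ⁆ ∪ p) x ≡ p
flip-⁅x⁆∪p {x = 0F}       (outside ∷ p) _   = cong (outside ∷_) (∪-identityˡ p)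
flip-⁅x⁆∪p {x = 0F}       (inside ∷ p)  x∉p = contradiction here x∉p
flip-⁅x⁆∪p {x = Fin.suc x} (b ∷ p)       x∉p = cong (b ∷_) (flip-⁅x⁆∪p p (x∉p ∘ there))

module Gadget {n : ℕ} (3<n : 3 < n) (s : Fin n → Fin n) (s-injective : Injective≡ s)
              (s-no-fixed-point : ∀ i → s i ≢ i) (s²-no-fixed-point : ∀ i → s (s i) ≢ i) where

  gadget : Fin n × Fin 3 → Config n
  gadget (j , 0F) = ⁅ j ⁆ ∪ ⁅ s j ⁆
  gadget (j , 1F) = ⁅ s j ⁆
  gadget (j , 2F) = ∁ ⁅ s j ⁆

  size : Fin 3 → ℕ
  size 0F = 2
  size 1F = 1
  size 2F = n ∸ 1

  ∣gadget∣ : ∀ p → ∣ gadget p ∣ ≡ size (proj₂ p)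
  ∣gadget∣ (j , 0F) = ∣⁅x⁆∪⁅y⁆∣≡2 (s-no-fixed-point j ∘ sym)
  ∣gadget∣ (j , 1F) = ∣⁅x⁆∣≡1 (s j)
  ∣gadget∣ (j , 2F) = trans (∣∁p∣≡n∸∣p∣ ⁅ s j ⁆) (cong (n ∸_) (∣⁅x⁆∣≡1 (s j)))

  <3⇒≢n∸1 : ∀ {k} → k < 3 → k ≢ n ∸ 1
  <3⇒≢n∸1 k<3 e = ℕ.<⇒≱ k<3 (subst (3 ≤_) (sym e) (ℕ.∸-monoˡ-≤ 1 3<n))

  size-injective : Injective≡ size
  size-injective {0F} {0F} _ = refl
  size-injective {1F} {1F} _ = refl
  size-injective {2F} {2F} _ = refl
  size-injective {0F} {1F} ()
  size-injective {1F} {0F} ()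
  size-injective {0F} {2F} e = contradiction e (<3⇒≢n∸1 (s≤s (s≤s (s≤s z≤n))))
  size-injective {2F} {0F} e = contradiction (sym e) (<3⇒≢n∸1 (s≤s (s≤s (s≤s z≤n))))
  size-injective {1F} {2F} e = contradiction e (<3⇒≢n∸1 (s≤s (s≤s z≤n)))
  size-injective {2F} {1F} e = contradiction (sym e) (<3⇒≢n∸1 (s≤s (s≤s z≤n)))

  pair-injective : ∀ {j k} → ⁅ j ⁆ ∪ ⁅ s j ⁆ ≡ ⁅ k ⁆ ∪ ⁅ s k ⁆ → j ≡ k
  pair-injective {j} {k} eq with ∈⁅y⁆∪⁅z⁆ (subst (j ∈_) eq (x∈p∪q⁺ (inj₁ (x∈⁅x⁆ j))))
  ... | inj₁ j≡k = j≡k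
  ... | inj₂ refl with ∈⁅y⁆∪⁅z⁆ (subst (s j ∈_) eq (x∈p∪q⁺ (inj₂ (x∈⁅x⁆ (s j)))))
  ...   | inj₁ s²k≡k  = contradiction s²k≡k (s²-no-fixed-point k)
  ...   | inj₂ s²k≡sk = s-injective s²k≡sk

  gadget-injectiveˡ : ∀ {j k} a → gadget (j , a) ≡ gadget (k , a) → j ≡ k
  gadget-injectiveˡ 0F = pair-injective
  gadget-injectiveˡ 1F = s-injective ∘ ⁅⁆-injective
  gadget-injectiveˡ 2F = s-injective ∘ ⁅⁆-injective ∘ ∁-injective

  gadget-injective : Injective≡ gadget
  gadget-injective {j , a} {k , b} eq
    with refl ← size-injective {a} {b}
                  (trans (sym (∣gadget∣ (j , a))) (trans (cong ∣_∣ eq) (∣gadget∣ (k , b))))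
    = cong (_, a) (gadget-injectiveˡ a eq)

  flip-gadget : ∀ j → flip (gadget (j , 0F)) j ≡ gadget (j , 1F)
  flip-gadget j = flip-⁅x⁆∪p ⁅ s j ⁆ (s-no-fixed-point j ∘ sym ∘ x∈⁅y⁆⇒x≡y (s j))

  gadget-paths⇒complete : ∀ {h : BN n} → Paths h gadget → IsComplete h
  gadget-paths⇒complete {h} h-paths = flip-complements⇒complete {h = h} λ j →
    gadget (j , 0F) , (begin
    h (flip (gadget (j , 0F)) j)  ≡⟨ cong h (flip-gadget j) ⟩
    h (gadget (j , 1F))           ≡⟨ Paths.second-step h-paths j ⟩
    ∁ (gadget (j , 1F))           ≡⟨ cong ∁ (Paths.first-step h-paths j) ⟨
    ∁ (h (gadget (j , 0F)))       ∎)
    where open ≡-Reasoning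

rotate : ∀ {n} → Fin (suc n) → Fin (suc n)
rotate 0F          = fromℕ _
rotate (Fin.suc i) = inject₁ i

rotate-injective : ∀ {n} → Injective≡ (rotate {n})
rotate-injective {x = 0F}        {0F}        _ = refl
rotate-injective {x = 0F}        {Fin.suc j} e = contradiction e Fin.fromℕ≢inject₁
rotate-injective {x = Fin.suc i} {0F}        e = contradiction (sym e) Fin.fromℕ≢inject₁
rotate-injective {x = Fin.suc i} {Fin.suc j} e = cong Fin.suc (Fin.inject₁-injective e)

rotate-no-fixed-point : ∀ {n} (i : Fin (2 + n)) → rotate i ≢ i
rotate-no-fixed-point 0F          ()
rotate-no-fixed-point (Fin.suc i) e =
  ℕ.1+n≢n (trans (sym (cong toℕ e)) (Fin.toℕ-inject₁ i))

rotate²-no-fixed-point : ∀ {n} (i : Fin (3 + n)) → rotate (rotate i) ≢ i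
rotate²-no-fixed-point 0F                    ()
rotate²-no-fixed-point 1F                    ()
rotate²-no-fixed-point (Fin.suc (Fin.suc i)) e = ℕ.m≢1+n+m (toℕ i) {1} (begin
  toℕ i                       ≡⟨ Fin.toℕ-inject₁ i ⟨
  toℕ (inject₁ i)             ≡⟨ Fin.toℕ-inject₁ (inject₁ i) ⟨
  toℕ (inject₁ (inject₁ i))   ≡⟨ cong toℕ e ⟩
  2 + toℕ i                   ∎)
  where open ≡-Reasoning

lemma2 : (n : ℕ) (f : BN n) → AtLeastCyclesOfLength≥3 f n → Kn∈𝒢 f
lemma2 0 f _ = f , conjugate-isomorphic ↔-refl f , λ ()
lemma2 1 f cycles = contradiction (cycles⇒m*3≤2^n cycles) (from-no (3 ℕ.≤? 2))
lemma2 2 f cycles = contradiction (cycles⇒m*3≤2^n cycles) (from-no (6 ℕ.≤? 4))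
lemma2 3 f cycles = contradiction (cycles⇒m*3≤2^n cycles) (from-no (9 ℕ.≤? 8))
lemma2 n@(suc (suc (suc (suc _)))) f cycles =
  let h , f≅h , h-paths =
        relabel-paths (first-points-injective cycles) gadget-injective (first-points-paths cycles)
  in  h , f≅h , gadget-paths⇒complete h-paths
  where
  open Gadget {n} (s≤s (s≤s (s≤s (s≤s z≤n)))) rotate rotate-injective
              rotate-no-fixed-point rotate²-no-fixed-point
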